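{- For every first-order language $L$ there is no uniform choice function for $Fml(L)$; that is, there is no choice function $f$ for $Fml(L)$ such that for all formulas $\alpha(\vec v),\beta(\vec v)$ of $L$ and every tuple $\vec t$ of terms substitutable for $\vec v$ in $\alpha$ and $\beta$, $$[f(\alpha(\vec v),\beta(\vec v))](\vec t)\ \sim\ f(\alpha(\vec t),\beta(\vec t)).$$
   Context: $Fml(L)$ is the set of formulas of $L$. A choice function for $Fml(L)$ is a map $f$ assigning to each unordered pair $\{\alpha,\beta\}$ of formulas of $L$ (singletons included) an element $f(\alpha,\beta)\in\{\alpha,\beta\}$; thus $f(\alpha,\beta)=f(\beta,\alpha)$. $\sim$ denotes logical equivalence in first-order logic. For a formula $\gamma(\vec v)$ and a tuple of terms $\vec t$ (terms may be variables), $\gamma(\vec t)$ denotes the simultaneous substitution of $\vec t$ for $\vec v$. -}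

module Defs where

open import Data.Nat using (ℕ; _≡ᵇ_)
open import Data.Bool using (Bool; if_then_else_)
open import Data.List using (List; []; _∷_; _++_; filter; [_])
open import Data.Vec using (Vec; []; _∷_; toList)
open import Data.Product using (_×_; Σ)
open import Data.Sum using (_⊎_)
open import Data.Unit using (⊤)
open import Data.Empty using (⊥)
open import Relation.Nullary using (¬_; does)
open import Relation.Binary.PropositionalEquality using (_≡_)
open import Data.List.Membership.Propositional using (_∈_; _∉_)
open import Data.List.Relation.Unary.All using (All)
open import Data.List.Relation.Unary.Unique.Propositional using (Unique)
import Data.Nat.Properties as ℕP

record Language : Set₁ where
  field
    Func  : Set
    Rel   : Set
    farity : Func → ℕ
    rarity : Rel → ℕ
open Language public

module _ (L : Language) where

  data Term : Set where
    var : ℕ → Term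
    app : (f : Func L) → Vec Term (farity L f) → Term

  infix  7 _≐_
  infixr 6 _∧'_
  infixr 5 _∨'_
  infixr 4 _⇒'_

  data Fml : Set where
    ⊥'   : Fml
    _≐_  : Term → Term → Fml
    rel  : (R : Rel L) → Vec Term (rarity L R) → Fml
    ¬'_  : Fml → Fml
    _∧'_ : Fml → Fml → Fml
    _∨'_ : Fml → Fml → Fml
    _⇒'_ : Fml → Fml → Fml
    ∀'   : ℕ → Fml → Fml
    ∃'   : ℕ → Fml → Fml

module _ {L : Language} where

  mutual
    tvars : Term L → List ℕ
    tvars (var x) = [ x ]
    tvars (app f ts) = tvarsV ts

    tvarsV : ∀ {n} → Vec (Term L) n → List ℕ
    tvarsV [] = []
    tvarsV (t ∷ ts) = tvars t ++ tvarsV ts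

  fv : Fml L → List ℕ
  fv ⊥' = []
  fv (t ≐ u) = tvars t ++ tvars u
  fv (rel R ts) = tvarsV ts
  fv (¬' φ) = fv φ
  fv (φ ∧' ψ) = fv φ ++ fv ψ
  fv (φ ∨' ψ) = fv φ ++ fv ψ
  fv (φ ⇒' ψ) = fv φ ++ fv ψ
  fv (∀' x φ) = filter (λ y → ¬? (y ℕP.≟ x)) (fv φ)
    where open import Relation.Nullary.Decidable using (¬?)
  fv (∃' x φ) = filter (λ y → ¬? (y ℕP.≟ x)) (fv φ)
    where open import Relation.Nullary.Decidable using (¬?)

  Subst : Set
  Subst = ℕ → Term L

  reset : Subst → ℕ → Subst
  reset σ x y = if x ≡ᵇ y then var y else σ y

  mutual
    tsub : Subst → Term L → Term L
    tsub σ (var x) = σ x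
    tsub σ (app f ts) = app f (tsubV σ ts)

    tsubV : ∀ {n} → Subst → Vec (Term L) n → Vec (Term L) n
    tsubV σ [] = []
    tsubV σ (t ∷ ts) = tsub σ t ∷ tsubV σ ts

  -- (capture-naive) substitution of σ for the free variables of a formula
  sub : Subst → Fml L → Fml L
  sub σ ⊥' = ⊥'
  sub σ (t ≐ u) = tsub σ t ≐ tsub σ u
  sub σ (rel R ts) = rel R (tsubV σ ts)
  sub σ (¬' φ) = ¬' sub σ φ
  sub σ (φ ∧' ψ) = sub σ φ ∧' sub σ ψ
  sub σ (φ ∨' ψ) = sub σ φ ∨' sub σ ψ
  sub σ (φ ⇒' ψ) = sub σ φ ⇒' sub σ ψ
  sub σ (∀' x φ) = ∀' x (sub (reset σ x) φ)
  sub σ (∃' x φ) = ∃' x (sub (reset σ x) φ)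

  Substitutable : Subst → Fml L → Set
  Substitutable σ ⊥' = ⊤
  Substitutable σ (t ≐ u) = ⊤
  Substitutable σ (rel R ts) = ⊤
  Substitutable σ (¬' φ) = Substitutable σ φ
  Substitutable σ (φ ∧' ψ) = Substitutable σ φ × Substitutable σ ψ
  Substitutable σ (φ ∨' ψ) = Substitutable σ φ × Substitutable σ ψ
  Substitutable σ (φ ⇒' ψ) = Substitutable σ φ × Substitutable σ ψ
  Substitutable σ (∀' x φ) =
    (∀ y → y ∈ fv (∀' x φ) → x ∉ tvars (σ y)) × Substitutable (reset σ x) φ
  Substitutable σ (∃' x φ) =
    (∀ y → y ∈ fv (∃' x φ) → x ∉ tvars (σ y)) × Substitutable (reset σ x) φ

  tupleSubst : ∀ {n} → Vec ℕ n → Vec (Term L) n → Subst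
  tupleSubst [] [] y = var y
  tupleSubst (v ∷ vs) (t ∷ ts) y = if v ≡ᵇ y then t else tupleSubst vs ts y

  infixl 8 _[_≔_]
  _[_≔_] : ∀ {n} → Fml L → Vec ℕ n → Vec (Term L) n → Fml L
  γ [ vs ≔ ts ] = sub (tupleSubst vs ts) γ

record Structure (L : Language) : Set₁ where
  field
    Dom   : Set
    elem  : Dom                                  -- nonempty domain
    funI  : (f : Func L) → Vec Dom (farity L f) → Dom
    relI  : (R : Rel L) → Vec Dom (rarity L R) → Set
open Structure public

module _ {L : Language} (M : Structure L) where

  update : (ℕ → Dom M) → ℕ → Dom M → ℕ → Dom M
  update s x d y = if x ≡ᵇ y then d else s y

  mutual
    ⟦_⟧t : Term L → (ℕ → Dom M) → Dom M
    ⟦ var x ⟧t s = s x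
    ⟦ app f ts ⟧t s = funI M f (⟦ ts ⟧ts s)

    ⟦_⟧ts : ∀ {n} → Vec (Term L) n → (ℕ → Dom M) → Vec (Dom M) n
    ⟦ [] ⟧ts s = []
    ⟦ t ∷ ts ⟧ts s = ⟦ t ⟧t s ∷ ⟦ ts ⟧ts s

  Sat : (ℕ → Dom M) → Fml L → Set
  Sat s ⊥' = ⊥
  Sat s (t ≐ u) = ⟦ t ⟧t s ≡ ⟦ u ⟧t s
  Sat s (rel R ts) = relI M R (⟦ ts ⟧ts s)
  Sat s (¬' φ) = ¬ Sat s φ
  Sat s (φ ∧' ψ) = Sat s φ × Sat s ψ
  Sat s (φ ∨' ψ) = Sat s φ ⊎ Sat s ψ
  Sat s (φ ⇒' ψ) = Sat s φ → Sat s ψ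
  Sat s (∀' x φ) = (d : Dom M) → Sat (update s x d) φ
  Sat s (∃' x φ) = Σ (Dom M) (λ d → Sat (update s x d) φ)

infix 3 _∼_
_∼_ : {L : Language} → Fml L → Fml L → Set₁
_∼_ {L} α β = (M : Structure L) (s : ℕ → Dom M) →
  (Sat M s α → Sat M s β) × (Sat M s β → Sat M s α)

-- Choice functions on unordered pairs {α, β} (singletons when α ≡ β)

IsChoiceFunction : {L : Language} → (Fml L → Fml L → Fml L) → Set
IsChoiceFunction f = ∀ α β → (f α β ≡ f β α) × ((f α β ≡ α) ⊎ (f α β ≡ β))

FreeAmong : ∀ {L n} → Fml L → Vec ℕ n → Set
FreeAmong γ vs = All (λ y → y ∈ toList vs) (fv γ)

IsUniform : {L : Language} → (Fml L → Fml L → Fml L) → Set₁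
IsUniform {L} f =
  ∀ {n} (vs : Vec ℕ n) (ts : Vec (Term L) n) (α β : Fml L) →
  Unique (toList vs) → FreeAmong α vs → FreeAmong β vs →
  Substitutable (tupleSubst vs ts) α → Substitutable (tupleSubst vs ts) β →
  (f α β) [ vs ≔ ts ] ∼ f (α [ vs ≔ ts ]) (β [ vs ≔ ts ])

-- Renaming v₁ ↔ v₂ exchanges  α = (v₀ ≐ v₁)  and  β = (v₀ ≐ v₂).  Uniformity then says
-- that the chosen formula f(α, β), after the renaming, is equivalent to
-- f(β, α) = f(α, β); since the renaming turns the chosen formula into the other one,
-- this forces α ∼ β.  But α and β are separated already in a two-element structure.
module Submission where

open import Defs
open import Data.Bool using (Bool; true; false)
open import Data.Nat using (ℕ)
open import Data.Product using (Σ; _×_; _,_; proj₁; swap)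
open import Data.Sum using (_⊎_; inj₁; inj₂)
open import Data.Unit using (tt)
open import Data.Vec using (Vec; []; _∷_; toList)
open import Data.List.Relation.Unary.All using ([]; _∷_)
open import Data.List.Relation.Unary.AllPairs using ([]; _∷_)
open import Data.List.Relation.Unary.Any using (here; there)
open import Data.List.Relation.Unary.Unique.Propositional using (Unique)
open import Relation.Binary.PropositionalEquality using (_≡_; refl; sym; subst; subst₂)
open import Relation.Nullary using (¬_)

module _ {L : Language} where

  ∼-sym : {α β : Fml L} → α ∼ β → β ∼ α
  ∼-sym α∼β M s = swap (α∼β M s)

  uniform-choice-identifies-exchanged :
    {f : Fml L → Fml L → Fml L} → IsChoiceFunction f → IsUniform f →
    ∀ {n} (vs : Vec ℕ n) (ts : Vec (Term L) n) (α β : Fml L) →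
    Unique (toList vs) → FreeAmong α vs → FreeAmong β vs →
    Substitutable (tupleSubst vs ts) α → Substitutable (tupleSubst vs ts) β →
    α [ vs ≔ ts ] ≡ β → β [ vs ≔ ts ] ≡ α → α ∼ β
  uniform-choice-identifies-exchanged {f} choice uniform vs ts α β
    unique freeα freeβ substα substβ α↦β β↦α
    with choice α β
  ... | f-comm , f-picks = from-choice f-picks
    where
    chosen-invariant : (f α β) [ vs ≔ ts ] ∼ f α β
    chosen-invariant =
      subst ((f α β) [ vs ≔ ts ] ∼_) (sym f-comm)
        (subst₂ (λ a b → (f α β) [ vs ≔ ts ] ∼ f a b) α↦β β↦α
          (uniform vs ts α β unique freeα freeβ substα substβ))

    invariant : (γ : Fml L) → f α β ≡ γ → γ [ vs ≔ ts ] ∼ γ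
    invariant γ f≡γ = subst (λ δ → δ [ vs ≔ ts ] ∼ δ) f≡γ chosen-invariant

    from-choice : (f α β ≡ α) ⊎ (f α β ≡ β) → α ∼ β
    from-choice (inj₁ f≡α) = ∼-sym {β} {α} (subst (_∼ α) α↦β (invariant α f≡α))
    from-choice (inj₂ f≡β) = subst (_∼ β) β↦α (invariant β f≡β)

module _ (L : Language) where

  v₀≐v₁ v₀≐v₂ : Fml L
  v₀≐v₁ = var 0 ≐ var 1
  v₀≐v₂ = var 0 ≐ var 2

  twoPoint : Structure L
  twoPoint = record { Dom = Bool ; elem = true ; funI = λ _ _ → true ; relI = λ _ _ → Bool }

  v₀=v₁≠v₂ : ℕ → Bool
  v₀=v₁≠v₂ 0 = true
  v₀=v₁≠v₂ 1 = true
  v₀=v₁≠v₂ _ = false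

  v₀≐v₁≁v₀≐v₂ : ¬ (v₀≐v₁ ∼ v₀≐v₂)
  v₀≐v₁≁v₀≐v₂ equiv with proj₁ (equiv twoPoint v₀=v₁≠v₂) refl
  ... | ()

proposition4p2 : (L : Language) →
    ¬ Σ (Fml L → Fml L → Fml L) (λ f → IsChoiceFunction f × IsUniform f)
proposition4p2 L (_ , choice , uniform) =
  v₀≐v₁≁v₀≐v₂ L
    (uniform-choice-identifies-exchanged choice uniform
      (0 ∷ 1 ∷ 2 ∷ []) (var 0 ∷ var 2 ∷ var 1 ∷ []) (v₀≐v₁ L) (v₀≐v₂ L)
      distinct (here refl ∷ there (here refl) ∷ []) (here refl ∷ there (there (here refl)) ∷ [])
      tt tt refl refl)
  where
  distinct : Unique (toList (0 ∷ 1 ∷ 2 ∷ []))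
  distinct = ((λ ()) ∷ (λ ()) ∷ []) ∷ ((λ ()) ∷ []) ∷ [] ∷ []
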